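{- Let $G$ be a non-regular graph on $n$ vertices, let $u,v$ be vertices of $G$ with $d_G(u)<d_G(v)$, let $R=V(G)\setminus\{u,v\}$, and define $X=N(u)\setminus N[v]$, $Y=N(v)\setminus N[u]$, $W=N(u)\cap N(v)$, and $Z=R\setminus(X\cup Y\cup W)$. If $F_k(G)$ is regular for some $2\le k\le n-2$, then $X=\emptyset$ and $Z=\emptyset$.
   Context: All graphs are finite and simple. $N(w)$ is the set of neighbours of $w$ in $G$, $N[w]=N(w)\cup\{w\}$, and $d_G(w)=|N(w)|$. For a graph $G=(V,E)$ on $n$ vertices and $1\le k<n$, the $k$-token graph $F_k(G)$ has as vertices the $k$-element subsets of $V$, with $A,B$ adjacent whenever $A\triangle B=\{a,b\}$ for some edge $ab$ of $G$. -}

module Defs where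

open import Data.Nat using (ℕ; zero; suc; _≡ᵇ_)
open import Data.Bool using (Bool; true; false; _∧_; _xor_)
open import Data.Fin using (Fin)
open import Data.Fin.Subset using (Subset; ⁅_⁆; _∪_; ∣_∣)
open import Data.List using (List; []; _∷_; _++_; map; length; filter; allFin)
open import Data.Bool.ListAction using (any)
open import Data.Vec using (Vec; []; _∷_; tabulate; zipWith)
open import Data.Vec.Properties using (≡-dec)
open import Relation.Nullary.Decidable using (⌊_⌋; T?)
open import Relation.Binary.PropositionalEquality using (_≡_)
import Data.Bool as B

record Graph (n : ℕ) : Set where
  field
    adj    : Fin n → Fin n → Bool
    sym    : ∀ i j → adj i j ≡ adj j i
    irrefl : ∀ i → adj i i ≡ false
open Graph public

module _ {n : ℕ} (G : Graph n) where
  N : Fin n → Subset n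
  N w = tabulate (adj G w)

  N[_] : Fin n → Subset n
  N[ w ] = N w ∪ ⁅ w ⁆

  deg : Fin n → ℕ
  deg w = ∣ N w ∣

  Regular : Set
  Regular = ∀ v w → deg v ≡ deg w

subsets : (n : ℕ) → List (Subset n)
subsets zero    = [] ∷ []
subsets (suc n) = map (false ∷_) (subsets n) ++ map (true ∷_) (subsets n)

_△_ : ∀ {n} → Subset n → Subset n → Subset n
A △ B = zipWith _xor_ A B

module _ {n : ℕ} (G : Graph n) where
  -- adjacency in the k-token graph: A △ B = {a,b} for some edge ab of G
  tokenAdj : Subset n → Subset n → Bool
  tokenAdj A B =
    any (λ a → any (λ b → adj G a b ∧ ⌊ ≡-dec B._≟_ (A △ B) (⁅ a ⁆ ∪ ⁅ b ⁆) ⌋) (allFin n)) (allFin n)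

  tokenDeg : ℕ → Subset n → ℕ
  tokenDeg k A = length (filter (λ B → T? ((∣ B ∣ ≡ᵇ k) ∧ tokenAdj A B)) (subsets n))

  TokenRegular : ℕ → Set
  TokenRegular k = ∀ A B → ∣ A ∣ ≡ k → ∣ B ∣ ≡ k → tokenDeg k A ≡ tokenDeg k B

-- The degree of a k-set A in F_k(G) is the number of edges of G leaving A, and adding
-- a vertex w ∉ T to a set T changes that number by d(w) − 2|N(w) ∩ T|. Regularity of
-- F_k(G) therefore gives d(u) + 2|N(v) ∩ T| = d(v) + 2|N(u) ∩ T| for every (k−1)-set
-- T ⊆ R. Comparing T = W ∪ {t} with T = W ∪ {s} (which needs k ≤ n − 2) shows that
-- [v ~ r] − [u ~ r] takes the same value on all of R, and d(u) < d(v) forces it to be 1: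
-- every vertex of R is adjacent to v and not to u, i.e. R ⊆ Y, whence X = Z = ∅.

module Submission where

open import Defs renaming (sym to adj-sym)
open import Data.Bool using (Bool; true; false; _∧_; _∨_; not; T)
import Data.Bool as B
open import Data.Bool.Properties using (not-involutive; not-¬; ∨-identityʳ; T-∧; T-≡)
open import Data.Fin using (Fin; zero; suc)
open import Data.Fin.Properties using (_≟_)
open import Data.Fin.Subset
  using (Subset; ⊤; ⊥; ⁅_⁆; _∪_; _∩_; _─_; _-_; ∣_∣; _∈_; _∉_; _⊆_; Empty)
open import Data.Fin.Subset.Properties
open import Data.List using (List; _∷_; []; _++_; map; length; filter; allFin)
open import Data.List.Membership.Propositional using (lose)
open import Data.List.Membership.Propositional.Properties using (∈-allFin)
open import Data.List.Properties using (map-++; map-∘; map-cong)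
import Data.Nat.ListAction as List
open import Data.Nat.ListAction.Properties using (sum-++)
open import Data.List.Relation.Unary.Any using (satisfied)
open import Data.List.Relation.Unary.Any.Properties using (any⁺; any⁻)
open import Data.Nat using (ℕ; zero; suc; _+_; _*_; _∸_; _≤_; _<_; _≡ᵇ_; s≤s)
open import Data.Nat.Properties hiding (_≟_)
open import Data.Nat.Tactic.RingSolver using (solve-∀)
open import Algebra.Properties.CommutativeSemigroup +-commutativeSemigroup using (xy∙z≈xz∙y)
open import Algebra.Properties.Semiring.Sum +-*-semiring
  using (sum; sum-syntax; sum-cong-≗; ∑-distrib-+; *-distribˡ-sum; sum-replicate-zero)
open import Data.Product using (_×_; _,_; ∃; ∃₂; proj₁; proj₂)
open import Data.Sum using (_⊎_; inj₁; inj₂; [_,_])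
open import Data.Vec using (_∷_; []; lookup; here; there)
open import Data.Vec.Properties
  using (≡-dec; ∷-injective; lookup∘tabulate; lookup-zipWith; lookup-replicate; []=⇒lookup; lookup⇒[]=)
open import Function using (_∘_; _⇔_; mk⇔; Equivalence)
open import Relation.Nullary using (¬_; Dec; yes; no; does; contradiction)
open import Relation.Nullary.Decidable using (⌊_⌋; T?; toWitness; fromWitness)
open import Relation.Binary.PropositionalEquality hiding ([_])

-- Finite sums

⟦_⟧ : Bool → ℕ
⟦ true ⟧  = 1
⟦ false ⟧ = 0

-- `does` rather than `⌊_⌋`, so that δ (suc a) (suc i) reduces to δ a i.
δ : ∀ {n} → Fin n → Fin n → Bool
δ a i = does (a ≟ i)

∑-δ : ∀ {n} (a : Fin n) (h : Fin n → ℕ) → ∑[ i < n ] (⟦ δ a i ⟧ * h i) ≡ h a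
∑-δ {suc n} zero    h = trans (cong₂ _+_ (+-identityʳ (h zero)) (sum-replicate-zero n)) (+-identityʳ (h zero))
∑-δ {suc n} (suc a) h = ∑-δ {n} a (h ∘ suc)

∑-point : ∀ {n} (a : Fin n) (h : Fin n → ℕ) → (∀ i → a ≢ i → h i ≡ 0) → ∑[ i < n ] h i ≡ h a
∑-point a h vanishes = trans (sum-cong-≗ spike) (∑-δ a h)
  where
  spike : ∀ i → h i ≡ ⟦ δ a i ⟧ * h i
  spike i with a ≟ i
  ... | yes refl = sym (*-identityˡ (h i))
  ... | no a≢i   = vanishes i a≢i

∑∑-distrib-+ : ∀ {m n} (f g : Fin m → Fin n → ℕ) →
  ∑[ a < m ] ∑[ b < n ] (f a b + g a b) ≡ ∑[ a < m ] ∑[ b < n ] f a b + ∑[ a < m ] ∑[ b < n ] g a b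
∑∑-distrib-+ {m} f g =
  trans (sum-cong-≗ {m} λ a → ∑-distrib-+ (f a) (g a)) (∑-distrib-+ (sum ∘ f) (sum ∘ g))

∑∑-δˡ : ∀ {m n} (w : Fin m) (h : Fin n → ℕ) → ∑[ a < m ] ∑[ b < n ] (⟦ δ w a ⟧ * h b) ≡ ∑[ b < n ] h b
∑∑-δˡ {m} w h = trans (sum-cong-≗ {m} λ a → sym (*-distribˡ-sum ⟦ δ w a ⟧ h)) (∑-δ w (λ _ → sum h))

∑∑-δʳ : ∀ {m n} (w : Fin n) (h : Fin m → ℕ) → ∑[ a < m ] ∑[ b < n ] (⟦ δ w b ⟧ * h a) ≡ ∑[ a < m ] h a
∑∑-δʳ {m} w h = sum-cong-≗ {m} λ a → ∑-δ w (λ _ → h a)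

⟦⟧≡0 : ∀ {x} → ¬ T x → ⟦ x ⟧ ≡ 0
⟦⟧≡0 {true}  ¬x = contradiction _ ¬x
⟦⟧≡0 {false} ¬x = refl

∑∑-indicator : ∀ {n} (s : Bool) (g : Fin n → Fin n → Bool) →
  (∀ {a b} → T (g a b) → T s) →
  (T s → ∃₂ λ a b → T (g a b)) →
  (∀ {a b a′ b′} → T (g a b) → T (g a′ b′) → a ≡ a′ × b ≡ b′) →
  ⟦ s ⟧ ≡ ∑[ a < n ] ∑[ b < n ] ⟦ g a b ⟧
∑∑-indicator {n} false g sound _ _ = sym (begin
  ∑[ a < n ] ∑[ b < n ] ⟦ g a b ⟧ ≡⟨ sum-cong-≗ {n} (λ a → sum-cong-≗ {n} λ b → ⟦⟧≡0 sound) ⟩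
  ∑[ a < n ] ∑[ b < n ] 0         ≡⟨ sum-cong-≗ {n} (λ _ → sum-replicate-zero n) ⟩
  ∑[ a < n ] 0                    ≡⟨ sum-replicate-zero n ⟩
  0                               ∎)
  where open ≡-Reasoning
∑∑-indicator {n} true g _ complete unique with complete _
... | a , b , gab = sym (begin
  ∑[ a′ < n ] ∑[ b′ < n ] ⟦ g a′ b′ ⟧ ≡⟨ ∑-point a _ (λ a′ a≢a′ → other-rows-vanish a≢a′) ⟩
  ∑[ b′ < n ] ⟦ g a b′ ⟧               ≡⟨ ∑-point b _ (λ b′ b≢b′ → ⟦⟧≡0 (b≢b′ ∘ proj₂ ∘ unique gab)) ⟩
  ⟦ g a b ⟧                             ≡⟨ cong ⟦_⟧ (Equivalence.to T-≡ gab) ⟩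
  1                                     ∎)
  where
  open ≡-Reasoning
  other-rows-vanish : ∀ {a′} → a ≢ a′ → ∑[ b′ < n ] ⟦ g a′ b′ ⟧ ≡ 0
  other-rows-vanish a≢a′ =
    trans (sum-cong-≗ {n} λ b′ → ⟦⟧≡0 (a≢a′ ∘ proj₁ ∘ unique gab)) (sum-replicate-zero n)

∑ˡ : ∀ {A : Set} → List A → (A → ℕ) → ℕ
∑ˡ xs h = List.sum (map h xs)

length-filter≡∑ˡ : ∀ {A : Set} (g : A → Bool) (xs : List A) →
  length (filter (λ x → T? (g x)) xs) ≡ ∑ˡ xs (λ x → ⟦ g x ⟧)
length-filter≡∑ˡ g []       = refl
length-filter≡∑ˡ g (x ∷ xs) with g x
... | true  = cong suc (length-filter≡∑ˡ g xs)
... | false = length-filter≡∑ˡ g xs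

∑ˡ-cong : ∀ {A : Set} (xs : List A) {g h : A → ℕ} → (∀ x → g x ≡ h x) → ∑ˡ xs g ≡ ∑ˡ xs h
∑ˡ-cong xs g≗h = cong List.sum (map-cong g≗h xs)

∑ˡ-++ : ∀ {A : Set} (xs ys : List A) (h : A → ℕ) → ∑ˡ (xs ++ ys) h ≡ ∑ˡ xs h + ∑ˡ ys h
∑ˡ-++ xs ys h = trans (cong List.sum (map-++ h xs ys)) (sum-++ (map h xs) (map h ys))

∑ˡ-map : ∀ {A B : Set} (f : A → B) (xs : List A) (h : B → ℕ) → ∑ˡ (map f xs) h ≡ ∑ˡ xs (h ∘ f)
∑ˡ-map f xs h = cong List.sum (sym (map-∘ xs))

∑ˡ-∑ : ∀ {A : Set} {n} (xs : List A) (h : Fin n → A → ℕ) →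
  ∑ˡ xs (λ x → ∑[ i < n ] h i x) ≡ ∑[ i < n ] ∑ˡ xs (h i)
∑ˡ-∑ {n = n} []       h = sym (sum-replicate-zero n)
∑ˡ-∑ {n = n} (x ∷ xs) h =
  trans (cong (∑[ i < n ] h i x +_) (∑ˡ-∑ xs h)) (sym (∑-distrib-+ (λ i → h i x) (λ i → ∑ˡ xs (h i))))

∑ˡ-subsets-point : ∀ {n} (C : Subset n) (h : Subset n → ℕ) → (∀ B → B ≢ C → h B ≡ 0) →
  ∑ˡ (subsets n) h ≡ h C
∑ˡ-subsets-point []      h vanishes = +-identityʳ (h [])
∑ˡ-subsets-point {suc n} (c ∷ C) h vanishes = begin
  ∑ˡ (map (false ∷_) S ++ map (true ∷_) S) h        ≡⟨ ∑ˡ-++ (map (false ∷_) S) _ h ⟩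
  ∑ˡ (map (false ∷_) S) h + ∑ˡ (map (true ∷_) S) h  ≡⟨ cong₂ _+_ (∑ˡ-map (false ∷_) S h) (∑ˡ-map (true ∷_) S h) ⟩
  ∑ˡ S (h ∘ (false ∷_)) + ∑ˡ S (h ∘ (true ∷_))      ≡⟨ cong₂ _+_ (∑ˡ-subsets-point C _ (off false)) (∑ˡ-subsets-point C _ (off true)) ⟩
  h (false ∷ C) + h (true ∷ C)                       ≡⟨ pick c vanishes ⟩
  h (c ∷ C)                                          ∎
  where
  open ≡-Reasoning
  S = subsets n
  off : ∀ b B → B ≢ C → h (b ∷ B) ≡ 0
  off b B B≢C = vanishes (b ∷ B) (B≢C ∘ proj₂ ∘ ∷-injective)
  pick : ∀ c → (∀ B → B ≢ c ∷ C → h B ≡ 0) → h (false ∷ C) + h (true ∷ C) ≡ h (c ∷ C)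
  pick false h-off = trans (cong (h (false ∷ C) +_) (h-off (true ∷ C) (λ ()))) (+-identityʳ _)
  pick true  h-off = cong (_+ h (true ∷ C)) (h-off (false ∷ C) (λ ()))

⟦⟧<⟦⟧ : ∀ {x y} → ⟦ x ⟧ < ⟦ y ⟧ → x ≡ false × y ≡ true
⟦⟧<⟦⟧ {false} {true}  _          = refl , refl
⟦⟧<⟦⟧ {true}  {true}  (s≤s ())
⟦⟧<⟦⟧ {_}     {false} ()

⟦⟧≤⟦⟧⇒ : ∀ {x y} → ⟦ x ⟧ ≤ ⟦ y ⟧ → x ≡ true → y ≡ true
⟦⟧≤⟦⟧⇒ {y = true}  _        _    = refl
⟦⟧≤⟦⟧⇒ {y = false} ()       refl

≤-transfer : ∀ {a b c d} → a + d ≡ c + b → a ≤ b → c ≤ d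
≤-transfer {a} {b} {c} {d} a+d≡c+b a≤b = +-cancelʳ-≤ b c d (begin
  c + b ≡⟨ a+d≡c+b ⟨
  a + d ≤⟨ +-monoˡ-≤ d a≤b ⟩
  b + d ≡⟨ +-comm b d ⟩
  d + b ∎)
  where open ≤-Reasoning

cross-cancel : ∀ {x y c p q d e} → x ≡ y → x + p ≡ c + d → y + q ≡ c + e → d + q ≡ e + p
cross-cancel {x} {_} {c} {p} {q} {d} {e} refl x+p≡c+d x+q≡c+e = +-cancelˡ-≡ c _ _ (begin
  c + (d + q) ≡⟨ +-assoc c d q ⟨
  c + d + q   ≡⟨ cong (_+ q) x+p≡c+d ⟨
  x + p + q   ≡⟨ xy∙z≈xz∙y x p q ⟩
  x + q + p   ≡⟨ cong (_+ p) x+q≡c+e ⟩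
  c + e + p   ≡⟨ +-assoc c e p ⟩
  c + (e + p) ∎)
  where open ≡-Reasoning

exchange-arith : ∀ du dv a b x y x′ y′ →
  du + 2 * (a + x) ≡ dv + 2 * (b + y) → du + 2 * (a + x′) ≡ dv + 2 * (b + y′) → x + y′ ≡ x′ + y
exchange-arith du dv a b x y x′ y′ e e′ = *-cancelˡ-≡ _ _ 2 (+-cancelˡ-≡ (du + dv + 2 * a + 2 * b) _ _ (begin
  du + dv + 2 * a + 2 * b + 2 * (x + y′)   ≡⟨ regroup du dv a b x y′ ⟩
  du + 2 * (a + x) + (dv + 2 * (b + y′))   ≡⟨ cong₂ _+_ e (sym e′) ⟩
  dv + 2 * (b + y) + (du + 2 * (a + x′))   ≡⟨ +-comm (dv + 2 * (b + y)) _ ⟩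
  du + 2 * (a + x′) + (dv + 2 * (b + y))   ≡⟨ regroup du dv a b x′ y ⟨
  du + dv + 2 * a + 2 * b + 2 * (x′ + y)   ∎))
  where
  open ≡-Reasoning
  regroup : ∀ du dv a b x y →
    du + dv + 2 * a + 2 * b + 2 * (x + y) ≡ du + 2 * (a + x) + (dv + 2 * (b + y))
  regroup = solve-∀

exactly-one⁺ : ∀ {x y} → T x → T (not y) → ⟦ x ⟧ + ⟦ y ⟧ ≡ 1
exactly-one⁺ {true} {false} _ _ = refl

exactly-one⁻ : ∀ x y → ⟦ x ⟧ + ⟦ y ⟧ ≡ 1 → (T x × T (not y)) ⊎ (T y × T (not x))
exactly-one⁻ true  false _ = inj₁ _
exactly-one⁻ false true  _ = inj₂ _

-- Subsets

lookup-⁅⁆ : ∀ {n} (a i : Fin n) → lookup ⁅ a ⁆ i ≡ δ a i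
lookup-⁅⁆ zero    zero    = refl
lookup-⁅⁆ zero    (suc i) = lookup-replicate i false
lookup-⁅⁆ (suc a) zero    = refl
lookup-⁅⁆ (suc a) (suc i) = lookup-⁅⁆ a i

∉⇒lookup≡false : ∀ {n} {x : Fin n} {p : Subset n} → x ∉ p → lookup p x ≡ false
∉⇒lookup≡false {x = x} {p} x∉p with lookup p x in eq
... | true  = contradiction (lookup⇒[]= x p eq) x∉p
... | false = refl

∣p∣≡∑ : ∀ {n} (p : Subset n) → ∣ p ∣ ≡ ∑[ i < n ] ⟦ lookup p i ⟧
∣p∣≡∑ []          = refl
∣p∣≡∑ (true ∷ p)  = cong suc (∣p∣≡∑ p)
∣p∣≡∑ (false ∷ p) = ∣p∣≡∑ p

x∈p─q⇒x∉q : ∀ {n} {x : Fin n} (p q : Subset n) → x ∈ p ─ q → x ∉ q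
x∈p─q⇒x∉q (_ ∷ p) (true ∷ q) ()         here
x∈p─q⇒x∉q (_ ∷ p) (_ ∷ q)    (there x∈) (there x∈q) = x∈p─q⇒x∉q p q x∈ x∈q

∣p-x∣+1≡∣p∣ : ∀ {n} {x : Fin n} {p : Subset n} → x ∈ p → suc ∣ p - x ∣ ≡ ∣ p ∣
∣p-x∣+1≡∣p∣ {p = true ∷ p}  here        = cong (suc ∘ ∣_∣) (p─⊥≡p p)
∣p-x∣+1≡∣p∣ {p = true ∷ p}  (there x∈p) = cong suc (∣p-x∣+1≡∣p∣ x∈p)
∣p-x∣+1≡∣p∣ {p = false ∷ p} (there x∈p) = ∣p-x∣+1≡∣p∣ x∈p

∣q∩[p∪⁅x⁆]∣ : ∀ {n} {x : Fin n} {p : Subset n} (q : Subset n) → x ∉ p →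
  ∣ q ∩ (p ∪ ⁅ x ⁆) ∣ ≡ ∣ q ∩ p ∣ + ⟦ lookup q x ⟧
∣q∩[p∪⁅x⁆]∣ {x = zero} {true ∷ p} _ x∉p = contradiction here x∉p
∣q∩[p∪⁅x⁆]∣ {x = zero} {false ∷ p} (true ∷ q) _ =
  trans (cong (λ r → suc ∣ q ∩ r ∣) (∪-identityʳ p)) (+-comm 1 ∣ q ∩ p ∣)
∣q∩[p∪⁅x⁆]∣ {x = zero} {false ∷ p} (false ∷ q) _ =
  trans (cong (λ r → ∣ q ∩ r ∣) (∪-identityʳ p)) (sym (+-identityʳ ∣ q ∩ p ∣))
∣q∩[p∪⁅x⁆]∣ {x = suc x} {true ∷ p}  (true ∷ q)  x∉p = cong suc (∣q∩[p∪⁅x⁆]∣ q (drop-not-there x∉p))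
∣q∩[p∪⁅x⁆]∣ {x = suc x} {false ∷ p} (true ∷ q)  x∉p = ∣q∩[p∪⁅x⁆]∣ q (drop-not-there x∉p)
∣q∩[p∪⁅x⁆]∣ {x = suc x} {_ ∷ p}     (false ∷ q) x∉p = ∣q∩[p∪⁅x⁆]∣ q (drop-not-there x∉p)

∣p∪⁅x⁆∣ : ∀ {n} {x : Fin n} {p : Subset n} → x ∉ p → ∣ p ∪ ⁅ x ⁆ ∣ ≡ suc ∣ p ∣
∣p∪⁅x⁆∣ {x = x} {p} x∉p = begin
  ∣ p ∪ ⁅ x ⁆ ∣               ≡⟨ cong ∣_∣ (∩-identityˡ (p ∪ ⁅ x ⁆)) ⟨
  ∣ ⊤ ∩ (p ∪ ⁅ x ⁆) ∣         ≡⟨ ∣q∩[p∪⁅x⁆]∣ ⊤ x∉p ⟩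
  ∣ ⊤ ∩ p ∣ + ⟦ lookup ⊤ x ⟧ ≡⟨ cong₂ (λ r b → ∣ r ∣ + ⟦ b ⟧) (∩-identityˡ p) (lookup-replicate x true) ⟩
  ∣ p ∣ + 1                   ≡⟨ +-comm ∣ p ∣ 1 ⟩
  suc ∣ p ∣                   ∎
  where open ≡-Reasoning

⊆-of-size : ∀ {n} m (p : Subset n) → m ≤ ∣ p ∣ → ∃ λ q → q ⊆ p × ∣ q ∣ ≡ m
⊆-of-size {n} zero p _ = ⊥ , ⊆-min p , ∣⊥∣≡0 n
⊆-of-size (suc m) (true ∷ p)  (s≤s m≤∣p∣) with ⊆-of-size m p m≤∣p∣
... | q , q⊆p , ∣q∣≡m = true ∷ q , in⊆in q⊆p , cong suc ∣q∣≡m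
⊆-of-size (suc m) (false ∷ p) m<∣p∣ with ⊆-of-size (suc m) p m<∣p∣
... | q , q⊆p , ∣q∣≡m = false ∷ q , out⊆ q⊆p , ∣q∣≡m

∣p△q∣+2∣p∩q∣≡∣p∣+∣q∣ : ∀ {n} (p q : Subset n) → ∣ p △ q ∣ + 2 * ∣ p ∩ q ∣ ≡ ∣ p ∣ + ∣ q ∣
∣p△q∣+2∣p∩q∣≡∣p∣+∣q∣ [] [] = refl
∣p△q∣+2∣p∩q∣≡∣p∣+∣q∣ (true ∷ p) (true ∷ q) = begin
  d + 2 * suc c       ≡⟨ cong (d +_) (*-suc 2 c) ⟩
  d + (2 + 2 * c)     ≡⟨ +-comm d (2 + 2 * c) ⟩
  2 + (2 * c + d)     ≡⟨ cong (2 +_) (+-comm (2 * c) d) ⟩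
  2 + (d + 2 * c)     ≡⟨ cong (2 +_) (∣p△q∣+2∣p∩q∣≡∣p∣+∣q∣ p q) ⟩
  2 + (∣ p ∣ + ∣ q ∣) ≡⟨ cong suc (+-suc ∣ p ∣ ∣ q ∣) ⟨
  suc ∣ p ∣ + suc ∣ q ∣ ∎
  where
  open ≡-Reasoning
  d = ∣ p △ q ∣
  c = ∣ p ∩ q ∣
∣p△q∣+2∣p∩q∣≡∣p∣+∣q∣ (true ∷ p)  (false ∷ q) = cong suc (∣p△q∣+2∣p∩q∣≡∣p∣+∣q∣ p q)
∣p△q∣+2∣p∩q∣≡∣p∣+∣q∣ (false ∷ p) (true ∷ q)  =
  trans (cong suc (∣p△q∣+2∣p∩q∣≡∣p∣+∣q∣ p q)) (sym (+-suc ∣ p ∣ ∣ q ∣))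
∣p△q∣+2∣p∩q∣≡∣p∣+∣q∣ (false ∷ p) (false ∷ q) = ∣p△q∣+2∣p∩q∣≡∣p∣+∣q∣ p q

p△[p△q]≡q : ∀ {n} (p q : Subset n) → p △ (p △ q) ≡ q
p△[p△q]≡q []          []      = refl
p△[p△q]≡q (true ∷ p)  (y ∷ q) = cong₂ _∷_ (not-involutive y) (p△[p△q]≡q p q)
p△[p△q]≡q (false ∷ p) (y ∷ q) = cong (y ∷_) (p△[p△q]≡q p q)

pair : ∀ {n} → Fin n → Fin n → Subset n
pair a b = ⁅ a ⁆ ∪ ⁅ b ⁆

∣q∩pair∣ : ∀ {n} {a b : Fin n} (q : Subset n) → a ≢ b → ∣ q ∩ pair a b ∣ ≡ ⟦ lookup q a ⟧ + ⟦ lookup q b ⟧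
∣q∩pair∣ {n} {a} {b} q a≢b = begin
  ∣ q ∩ pair a b ∣                          ≡⟨ ∣q∩[p∪⁅x⁆]∣ q (x≢y⇒x∉⁅y⁆ (a≢b ∘ sym)) ⟩
  ∣ q ∩ ⁅ a ⁆ ∣ + ⟦ lookup q b ⟧                    ≡⟨ cong (λ r → ∣ q ∩ r ∣ + ⟦ lookup q b ⟧) (∪-identityˡ ⁅ a ⁆) ⟨
  ∣ q ∩ (⊥ ∪ ⁅ a ⁆) ∣ + ⟦ lookup q b ⟧              ≡⟨ cong (_+ ⟦ lookup q b ⟧) (∣q∩[p∪⁅x⁆]∣ q ∉⊥) ⟩
  ∣ q ∩ ⊥ ∣ + ⟦ lookup q a ⟧ + ⟦ lookup q b ⟧       ≡⟨ cong (λ r → ∣ r ∣ + ⟦ lookup q a ⟧ + ⟦ lookup q b ⟧) (∩-zeroʳ q) ⟩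
  ∣ ⊥ {n} ∣ + ⟦ lookup q a ⟧ + ⟦ lookup q b ⟧       ≡⟨ cong (λ c → c + ⟦ lookup q a ⟧ + ⟦ lookup q b ⟧) (∣⊥∣≡0 n) ⟩
  ⟦ lookup q a ⟧ + ⟦ lookup q b ⟧                   ∎
  where open ≡-Reasoning

∣pair∣ : ∀ {n} {a b : Fin n} → a ≢ b → ∣ pair a b ∣ ≡ 2
∣pair∣ {a = a} {b} a≢b = begin
  ∣ pair a b ∣                   ≡⟨ cong ∣_∣ (∩-identityˡ (pair a b)) ⟨
  ∣ ⊤ ∩ pair a b ∣               ≡⟨ ∣q∩pair∣ ⊤ a≢b ⟩
  ⟦ lookup ⊤ a ⟧ + ⟦ lookup ⊤ b ⟧ ≡⟨ cong₂ (λ x y → ⟦ x ⟧ + ⟦ y ⟧) (lookup-replicate a true) (lookup-replicate b true) ⟩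
  2                               ∎
  where open ≡-Reasoning

∣p△pair∣≡∣p∣⇔ : ∀ {n} {a b : Fin n} (p : Subset n) → a ≢ b →
  ∣ p △ pair a b ∣ ≡ ∣ p ∣ ⇔ ⟦ lookup p a ⟧ + ⟦ lookup p b ⟧ ≡ 1
∣p△pair∣≡∣p∣⇔ {a = a} {b} p a≢b = mk⇔ to from
  where
  x = ⟦ lookup p a ⟧ + ⟦ lookup p b ⟧
  count : ∣ p △ pair a b ∣ + 2 * x ≡ ∣ p ∣ + 2
  count = begin
    ∣ p △ pair a b ∣ + 2 * x                 ≡⟨ cong (λ c → ∣ p △ pair a b ∣ + 2 * c) (∣q∩pair∣ p a≢b) ⟨
    ∣ p △ pair a b ∣ + 2 * ∣ p ∩ pair a b ∣ ≡⟨ ∣p△q∣+2∣p∩q∣≡∣p∣+∣q∣ p (pair a b) ⟩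
    ∣ p ∣ + ∣ pair a b ∣                     ≡⟨ cong (∣ p ∣ +_) (∣pair∣ a≢b) ⟩
    ∣ p ∣ + 2                                 ∎
    where open ≡-Reasoning
  to : ∣ p △ pair a b ∣ ≡ ∣ p ∣ → x ≡ 1
  to eq = *-cancelˡ-≡ x 1 2 (+-cancelˡ-≡ ∣ p ∣ _ _ (trans (cong (λ c → c + 2 * x) (sym eq)) count))
  from : x ≡ 1 → ∣ p △ pair a b ∣ ≡ ∣ p ∣
  from eq = +-cancelʳ-≡ 2 _ _ (trans (cong (λ c → ∣ p △ pair a b ∣ + 2 * c) (sym eq)) count)

x∈pair⁻ : ∀ {n} {x a b : Fin n} → x ∈ pair a b → x ≡ a ⊎ x ≡ b
x∈pair⁻ {a = a} {b} x∈ with x∈p∪q⁻ ⁅ a ⁆ ⁅ b ⁆ x∈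
... | inj₁ x∈⁅a⁆ = inj₁ (x∈⁅y⁆⇒x≡y a x∈⁅a⁆)
... | inj₂ x∈⁅b⁆ = inj₂ (x∈⁅y⁆⇒x≡y b x∈⁅b⁆)

a∈pair : ∀ {n} (a b : Fin n) → a ∈ pair a b
a∈pair a b = x∈p∪q⁺ (inj₁ (x∈⁅x⁆ a))

b∈pair : ∀ {n} (a b : Fin n) → b ∈ pair a b
b∈pair a b = x∈p∪q⁺ (inj₂ (x∈⁅x⁆ b))

lookup-∪⁅⁆ : ∀ {n} (p : Subset n) (w i : Fin n) → lookup (p ∪ ⁅ w ⁆) i ≡ lookup p i ∨ δ w i
lookup-∪⁅⁆ p w i = trans (lookup-zipWith _∨_ i p ⁅ w ⁆) (cong (lookup p i ∨_) (lookup-⁅⁆ w i))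

∈∉⇒≢ : ∀ {n} {p : Subset n} {x y : Fin n} → T (lookup p x) → T (not (lookup p y)) → x ≢ y
∈∉⇒≢ {p = p} {x} x∈p y∉p refl with lookup p x
... | true  = y∉p
... | false = x∈p

p△q≡r⇒q≡p△r : ∀ {n} {p q r : Subset n} → p △ q ≡ r → q ≡ p △ r
p△q≡r⇒q≡p△r {p = p} {q} refl = sym (p△[p△q]≡q p q)

-- Token graphs

module _ {n : ℕ} (G : Graph n) where

  leaves : Subset n → Fin n → Fin n → Bool
  leaves p a b = lookup p a ∧ not (lookup p b) ∧ adj G a b

  boundary : Subset n → ℕ
  boundary p = ∑[ a < n ] ∑[ b < n ] ⟦ leaves p a b ⟧

  leaves⁺ : ∀ {p a b} → T (lookup p a) → T (not (lookup p b)) → T (adj G a b) → T (leaves p a b)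
  leaves⁺ a∈p b∉p ab = Equivalence.from T-∧ (a∈p , Equivalence.from T-∧ (b∉p , ab))

  leaves⁻ : ∀ {p a b} → T (leaves p a b) → T (lookup p a) × T (not (lookup p b)) × T (adj G a b)
  leaves⁻ l with Equivalence.to T-∧ l
  ... | a∈p , l′ = a∈p , Equivalence.to T-∧ l′

  adj⇒≢ : ∀ {a b} → T (adj G a b) → a ≢ b
  adj⇒≢ {a} ab refl = subst T (irrefl G a) ab

  tokenAdj⁺ : ∀ {A B a b} → T (adj G a b) → A △ B ≡ pair a b → T (tokenAdj G A B)
  tokenAdj⁺ {a = a} {b} ab A△B≡ab =
    any⁺ _ (lose (∈-allFin a) (any⁺ _ (lose (∈-allFin b) (Equivalence.from T-∧ (ab , fromWitness A△B≡ab)))))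

  tokenAdj⁻ : ∀ {A B} → T (tokenAdj G A B) → ∃₂ λ a b → T (adj G a b) × A △ B ≡ pair a b
  tokenAdj⁻ t with satisfied (any⁻ _ (allFin n) t)
  ... | a , ta with satisfied (any⁻ _ (allFin n) ta)
  ... | b , tb with Equivalence.to T-∧ tb
  ... | ab , A△B≡ab = a , b , ab , toWitness A△B≡ab

  module TokenNeighbours {k : ℕ} (A : Subset n) (∣A∣≡k : ∣ A ∣ ≡ k) where

    neighbour : Subset n → Bool
    neighbour B = (∣ B ∣ ≡ᵇ k) ∧ tokenAdj G A B

    _≟ₛ_ : (B C : Subset n) → Dec (B ≡ C)
    _≟ₛ_ = ≡-dec B._≟_

    -- B arises from A by sliding the token on a ∈ A along the edge ab to b ∉ A.
    move : Subset n → Fin n → Fin n → Bool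
    move B a b = ⌊ B ≟ₛ (A △ pair a b) ⌋ ∧ leaves A a b

    move⁺ : ∀ {B a b} → B ≡ A △ pair a b → T (leaves A a b) → T (move B a b)
    move⁺ {B} {a} {b} B≡A△ab l = Equivalence.from (T-∧ {⌊ B ≟ₛ (A △ pair a b) ⌋}) (fromWitness B≡A△ab , l)

    move⁻ : ∀ {B a b} → T (move B a b) → B ≡ A △ pair a b × T (leaves A a b)
    move⁻ {B} {a} {b} h with Equivalence.to (T-∧ {⌊ B ≟ₛ (A △ pair a b) ⌋}) h
    ... | B≡A△ab , l = toWitness B≡A△ab , l

    move⇒neighbour : ∀ {B a b} → T (move B a b) → T (neighbour B)
    move⇒neighbour {B} {a} {b} h with move⁻ {B} {a} {b} h
    ... | B≡A△ab , l with leaves⁻ {A} {a} {b} l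
    ... | a∈A , b∉A , ab = Equivalence.from T-∧ (≡⇒≡ᵇ ∣ B ∣ k ∣B∣≡k , tokenAdj⁺ {A} {B} ab A△B≡ab)
      where
      ∣B∣≡k : ∣ B ∣ ≡ k
      ∣B∣≡k = trans (cong ∣_∣ B≡A△ab)
        (trans (Equivalence.from (∣p△pair∣≡∣p∣⇔ A (adj⇒≢ ab)) (exactly-one⁺ a∈A b∉A)) ∣A∣≡k)
      A△B≡ab : A △ B ≡ pair a b
      A△B≡ab = trans (cong (A △_) B≡A△ab) (p△[p△q]≡q A (pair a b))

    neighbour⇒move : ∀ {B} → T (neighbour B) → ∃₂ λ a b → T (move B a b)
    neighbour⇒move {B} s with Equivalence.to (T-∧ {∣ B ∣ ≡ᵇ k}) s
    ... | ∣B∣≡ᵇk , A~B with tokenAdj⁻ A~B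
    ... | a , b , ab , A△B≡ab = orient (exactly-one⁻ (lookup A a) (lookup A b) one-endpoint-in-A)
      where
      B≡A△ab : B ≡ A △ pair a b
      B≡A△ab = p△q≡r⇒q≡p△r A△B≡ab
      one-endpoint-in-A : ⟦ lookup A a ⟧ + ⟦ lookup A b ⟧ ≡ 1
      one-endpoint-in-A = Equivalence.to (∣p△pair∣≡∣p∣⇔ A (adj⇒≢ ab))
        (trans (cong ∣_∣ (sym B≡A△ab)) (trans (≡ᵇ⇒≡ ∣ B ∣ k ∣B∣≡ᵇk) (sym ∣A∣≡k)))
      orient : (T (lookup A a) × T (not (lookup A b))) ⊎ (T (lookup A b) × T (not (lookup A a))) →
        ∃₂ λ a b → T (move B a b)
      orient (inj₁ (a∈A , b∉A)) = a , b , move⁺ B≡A△ab (leaves⁺ {A} a∈A b∉A ab)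
      orient (inj₂ (b∈A , a∉A)) = b , a ,
        move⁺ (trans B≡A△ab (cong (A △_) (∪-comm ⁅ a ⁆ ⁅ b ⁆))) (leaves⁺ {A} b∈A a∉A (subst T (adj-sym G a b) ab))

    move-unique : ∀ {B a b a′ b′} → T (move B a b) → T (move B a′ b′) → a ≡ a′ × b ≡ b′
    move-unique {B} {a} {b} {a′} {b′} h h′ with move⁻ {B} {a} {b} h | move⁻ {B} {a′} {b′} h′
    ... | B≡A△ab , l | B≡A△a′b′ , l′ with leaves⁻ {A} {a} {b} l | leaves⁻ {A} {a′} {b′} l′
    ... | a∈A , b∉A , _ | a′∈A , b′∉A , _ =
      tail-is-a′ (x∈pair⁻ (subst (a ∈_) same-pair (a∈pair a b))) ,
      head-is-b′ (x∈pair⁻ (subst (b ∈_) same-pair (b∈pair a b)))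
      where
      same-pair : pair a b ≡ pair a′ b′
      same-pair = trans (sym (p△[p△q]≡q A (pair a b)))
        (trans (cong (A △_) (trans (sym B≡A△ab) B≡A△a′b′)) (p△[p△q]≡q A (pair a′ b′)))
      tail-is-a′ : a ≡ a′ ⊎ a ≡ b′ → a ≡ a′
      tail-is-a′ (inj₁ a≡a′) = a≡a′
      tail-is-a′ (inj₂ a≡b′) = contradiction a≡b′ (∈∉⇒≢ {p = A} a∈A b′∉A)
      head-is-b′ : b ≡ a′ ⊎ b ≡ b′ → b ≡ b′
      head-is-b′ (inj₁ b≡a′) = contradiction (sym b≡a′) (∈∉⇒≢ {p = A} a′∈A b∉A)
      head-is-b′ (inj₂ b≡b′) = b≡b′

    ∑move≡leaves : ∀ a b → ∑ˡ (subsets n) (λ B → ⟦ move B a b ⟧) ≡ ⟦ leaves A a b ⟧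
    ∑move≡leaves a b = trans (∑ˡ-subsets-point C _ miss)
      (cong (λ d → ⟦ d ∧ leaves A a b ⟧) (Equivalence.to T-≡ (fromWitness {a? = C ≟ₛ C} refl)))
      where
      C = A △ pair a b
      miss : ∀ B → B ≢ C → ⟦ move B a b ⟧ ≡ 0
      miss B B≢C = ⟦⟧≡0 (B≢C ∘ proj₁ ∘ move⁻ {B} {a} {b})

  tokenDeg≡boundary : ∀ {k} (A : Subset n) → ∣ A ∣ ≡ k → tokenDeg G k A ≡ boundary A
  tokenDeg≡boundary {k} A ∣A∣≡k = begin
    tokenDeg G k A                                     ≡⟨ length-filter≡∑ˡ neighbour S ⟩
    ∑ˡ S (λ B → ⟦ neighbour B ⟧)                       ≡⟨ ∑ˡ-cong S count-moves ⟩
    ∑ˡ S (λ B → ∑[ a < n ] ∑[ b < n ] ⟦ move B a b ⟧) ≡⟨ ∑ˡ-∑ S (λ a B → ∑[ b < n ] ⟦ move B a b ⟧) ⟩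
    ∑[ a < n ] ∑ˡ S (λ B → ∑[ b < n ] ⟦ move B a b ⟧) ≡⟨ sum-cong-≗ {n} (λ a → ∑ˡ-∑ S (λ b B → ⟦ move B a b ⟧)) ⟩
    ∑[ a < n ] ∑[ b < n ] ∑ˡ S (λ B → ⟦ move B a b ⟧) ≡⟨ sum-cong-≗ {n} (λ a → sum-cong-≗ {n} (∑move≡leaves a)) ⟩
    boundary A                                         ∎
    where
    open ≡-Reasoning
    open TokenNeighbours A ∣A∣≡k
    S = subsets n
    count-moves : ∀ B → ⟦ neighbour B ⟧ ≡ ∑[ a < n ] ∑[ b < n ] ⟦ move B a b ⟧
    count-moves B = ∑∑-indicator (neighbour B) (move B) (move⇒neighbour {B}) (neighbour⇒move {B}) (move-unique {B})

  deg≡∑ : ∀ w → deg G w ≡ ∑[ j < n ] ⟦ adj G w j ⟧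
  deg≡∑ w = trans (∣p∣≡∑ (N G w)) (sum-cong-≗ {n} λ j → cong ⟦_⟧ (lookup∘tabulate (adj G w) j))

  ∣N∩p∣≡∑ : ∀ w p → ∣ N G w ∩ p ∣ ≡ ∑[ j < n ] ⟦ adj G w j ∧ lookup p j ⟧
  ∣N∩p∣≡∑ w p = trans (∣p∣≡∑ (N G w ∩ p)) (sum-cong-≗ {n} λ j → cong ⟦_⟧
    (trans (lookup-zipWith _∧_ j (N G w) p) (cong (_∧ lookup p j) (lookup∘tabulate (adj G w) j))))

  leaves-∪⁅⁆ : ∀ p w → w ∉ p → ∀ a b →
    ⟦ leaves (p ∪ ⁅ w ⁆) a b ⟧
      + (⟦ δ w a ⟧ * ⟦ adj G w b ∧ lookup p b ⟧ + ⟦ δ w b ⟧ * ⟦ adj G w a ∧ lookup p a ⟧)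
    ≡ ⟦ leaves p a b ⟧ + ⟦ δ w a ⟧ * ⟦ adj G w b ⟧
  leaves-∪⁅⁆ p w w∉p a b
    rewrite lookup-∪⁅⁆ p w a | lookup-∪⁅⁆ p w b with w ≟ a | w ≟ b
  ... | yes refl | yes refl rewrite ∉⇒lookup≡false w∉p | irrefl G w = refl
  ... | yes refl | no _ rewrite ∉⇒lookup≡false w∉p | ∨-identityʳ (lookup p b)
    with lookup p b | adj G w b
  ...   | true  | true  = refl
  ...   | true  | false = refl
  ...   | false | true  = refl
  ...   | false | false = refl
  leaves-∪⁅⁆ p w w∉p a b | no _ | yes refl rewrite ∉⇒lookup≡false w∉p | ∨-identityʳ (lookup p a) | adj-sym G a w
    with lookup p a | adj G w a
  ...   | true  | true  = refl
  ...   | true  | false = refl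
  ...   | false | true  = refl
  ...   | false | false = refl
  leaves-∪⁅⁆ p w w∉p a b | no _ | no _ rewrite ∨-identityʳ (lookup p a) | ∨-identityʳ (lookup p b) = refl

  boundary-∪⁅⁆ : ∀ p w → w ∉ p → boundary (p ∪ ⁅ w ⁆) + 2 * ∣ N G w ∩ p ∣ ≡ boundary p + deg G w
  boundary-∪⁅⁆ p w w∉p = begin
    boundary (p ∪ ⁅ w ⁆) + 2 * ∣ N G w ∩ p ∣
      ≡⟨ cong (boundary (p ∪ ⁅ w ⁆) +_) twice-∣N∩p∣ ⟩
    ∑∑ (λ a b → ⟦ leaves (p ∪ ⁅ w ⁆) a b ⟧) + ∑∑ (λ a b → ⟦ δ w a ⟧ * c b + ⟦ δ w b ⟧ * c a)
      ≡⟨ ∑∑-distrib-+ (λ a b → ⟦ leaves (p ∪ ⁅ w ⁆) a b ⟧) _ ⟨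
    ∑∑ (λ a b → ⟦ leaves (p ∪ ⁅ w ⁆) a b ⟧ + (⟦ δ w a ⟧ * c b + ⟦ δ w b ⟧ * c a))
      ≡⟨ sum-cong-≗ {n} (λ a → sum-cong-≗ {n} (leaves-∪⁅⁆ p w w∉p a)) ⟩
    ∑∑ (λ a b → ⟦ leaves p a b ⟧ + ⟦ δ w a ⟧ * ⟦ adj G w b ⟧)
      ≡⟨ ∑∑-distrib-+ (λ a b → ⟦ leaves p a b ⟧) _ ⟩
    boundary p + ∑∑ (λ a b → ⟦ δ w a ⟧ * ⟦ adj G w b ⟧)
      ≡⟨ cong (boundary p +_) (trans (∑∑-δˡ w (λ b → ⟦ adj G w b ⟧)) (sym (deg≡∑ w))) ⟩
    boundary p + deg G w
      ∎
    where
    open ≡-Reasoning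
    ∑∑ : (Fin n → Fin n → ℕ) → ℕ
    ∑∑ f = ∑[ a < n ] ∑[ b < n ] f a b
    c : Fin n → ℕ
    c j = ⟦ adj G w j ∧ lookup p j ⟧
    twice-∣N∩p∣ : 2 * ∣ N G w ∩ p ∣ ≡ ∑∑ (λ a b → ⟦ δ w a ⟧ * c b + ⟦ δ w b ⟧ * c a)
    twice-∣N∩p∣ = begin
      2 * ∣ N G w ∩ p ∣                                    ≡⟨ cong (2 *_) (∣N∩p∣≡∑ w p) ⟩
      2 * sum c                                            ≡⟨ cong (sum c +_) (+-identityʳ (sum c)) ⟩
      sum c + sum c                                        ≡⟨ cong₂ _+_ (∑∑-δˡ w c) (∑∑-δʳ w c) ⟨
      ∑∑ (λ a b → ⟦ δ w a ⟧ * c b) + ∑∑ (λ a b → ⟦ δ w b ⟧ * c a) ≡⟨ ∑∑-distrib-+ (λ a b → ⟦ δ w a ⟧ * c b) _ ⟨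
      ∑∑ (λ a b → ⟦ δ w a ⟧ * c b + ⟦ δ w b ⟧ * c a)     ∎

  ∈N⁺ : ∀ {w x} → adj G w x ≡ true → x ∈ N G w
  ∈N⁺ {w} {x} wx = lookup⇒[]= x (N G w) (trans (lookup∘tabulate (adj G w) x) wx)

  ∈N⁻ : ∀ {w x} → x ∈ N G w → adj G w x ≡ true
  ∈N⁻ {w} {x} x∈N = trans (sym (lookup∘tabulate (adj G w) x)) ([]=⇒lookup x∈N)

  ∉N⁺ : ∀ {w x} → adj G w x ≡ false → x ∉ N G w
  ∉N⁺ w≁x x∈N = not-¬ w≁x (∈N⁻ x∈N)

  ∈N⇒≢ : ∀ {w x} → x ∈ N G w → x ≢ w
  ∈N⇒≢ {w} x∈N refl = ∉N⁺ (irrefl G w) x∈N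

  ∣N∩[p∪⁅x⁆]∣ : ∀ {w x p} → x ∉ p → ∣ N G w ∩ (p ∪ ⁅ x ⁆) ∣ ≡ ∣ N G w ∩ p ∣ + ⟦ adj G w x ⟧
  ∣N∩[p∪⁅x⁆]∣ {w} {x} {p} x∉p =
    trans (∣q∩[p∪⁅x⁆]∣ (N G w) x∉p) (cong (λ b → ∣ N G w ∩ p ∣ + ⟦ b ⟧) (lookup∘tabulate (adj G w) x))

module UnequalDegrees {n} (G : Graph n) (m : ℕ) (regular : TokenRegular G (2 + m)) (room : 2 + m ≤ n ∸ 2)
                      {u v : Fin n} (du<dv : deg G u < deg G v) where

  u≢v : u ≢ v
  u≢v refl = <-irrefl refl du<dv

  R : Subset n
  R = ⊤ ─ pair u v

  ∈R⁺ : ∀ {x} → x ≢ u → x ≢ v → x ∈ R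
  ∈R⁺ x≢u x≢v = x∈p∧x∉q⇒x∈p─q ∈⊤ ([ x≢u , x≢v ] ∘ x∈pair⁻)

  ∈R⁻ : ∀ {x} → x ∈ R → x ≢ u × x ≢ v
  ∈R⁻ x∈R = (λ { refl → x∈p─q⇒x∉q ⊤ (pair u v) x∈R (a∈pair u v) })
          , (λ { refl → x∈p─q⇒x∉q ⊤ (pair u v) x∈R (b∈pair u v) })

  2+∣R∣≡n : 2 + ∣ R ∣ ≡ n
  2+∣R∣≡n = begin
    2 + ∣ R ∣               ≡⟨ cong (λ r → 2 + ∣ r ∣) (p─q─r≡p─q∪r ⊤ ⁅ u ⁆ ⁅ v ⁆) ⟨
    suc (suc ∣ ⊤ - u - v ∣) ≡⟨ cong suc (∣p-x∣+1≡∣p∣ (x∈p∧x≢y⇒x∈p-y ∈⊤ (u≢v ∘ sym))) ⟩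
    suc ∣ ⊤ - u ∣           ≡⟨ ∣p-x∣+1≡∣p∣ {x = u} {p = ⊤ {n}} ∈⊤ ⟩
    ∣ ⊤ {n} ∣               ≡⟨ ∣⊤∣≡n n ⟩
    n                       ∎
    where open ≡-Reasoning

  2+m≤∣R∣ : 2 + m ≤ ∣ R ∣
  2+m≤∣R∣ = subst (2 + m ≤_) (trans (cong (_∸ 2) (sym 2+∣R∣≡n)) (m+n∸m≡n 2 ∣ R ∣)) room

  degree-balance : ∀ T → T ⊆ R → suc ∣ T ∣ ≡ 2 + m →
    deg G u + 2 * ∣ N G v ∩ T ∣ ≡ deg G v + 2 * ∣ N G u ∩ T ∣
  degree-balance T T⊆R ∣T∣≡1+m =
    cross-cancel {c = boundary G T} same-boundary (boundary-∪⁅⁆ G T u u∉T) (boundary-∪⁅⁆ G T v v∉T)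
    where
    u∉T : u ∉ T
    u∉T u∈T = proj₁ (∈R⁻ (T⊆R u∈T)) refl
    v∉T : v ∉ T
    v∉T v∈T = proj₂ (∈R⁻ (T⊆R v∈T)) refl
    ∣T∪⁅u⁆∣ : ∣ T ∪ ⁅ u ⁆ ∣ ≡ 2 + m
    ∣T∪⁅u⁆∣ = trans (∣p∪⁅x⁆∣ u∉T) ∣T∣≡1+m
    ∣T∪⁅v⁆∣ : ∣ T ∪ ⁅ v ⁆ ∣ ≡ 2 + m
    ∣T∪⁅v⁆∣ = trans (∣p∪⁅x⁆∣ v∉T) ∣T∣≡1+m
    same-boundary : boundary G (T ∪ ⁅ u ⁆) ≡ boundary G (T ∪ ⁅ v ⁆)
    same-boundary = trans (sym (tokenDeg≡boundary G (T ∪ ⁅ u ⁆) ∣T∪⁅u⁆∣))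
      (trans (regular (T ∪ ⁅ u ⁆) (T ∪ ⁅ v ⁆) ∣T∪⁅u⁆∣ ∣T∪⁅v⁆∣) (tokenDeg≡boundary G (T ∪ ⁅ v ⁆) ∣T∪⁅v⁆∣))

  degree-balance-∪⁅⁆ : ∀ {x} W → W ⊆ R → ∣ W ∣ ≡ m → x ∈ R → x ∉ W →
    deg G u + 2 * (∣ N G v ∩ W ∣ + ⟦ adj G v x ⟧) ≡ deg G v + 2 * (∣ N G u ∩ W ∣ + ⟦ adj G u x ⟧)
  degree-balance-∪⁅⁆ {x} W W⊆R ∣W∣≡m x∈R x∉W = subst₂ (λ i j → deg G u + 2 * i ≡ deg G v + 2 * j)
    (∣N∩[p∪⁅x⁆]∣ G x∉W) (∣N∩[p∪⁅x⁆]∣ G x∉W)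
    (degree-balance (W ∪ ⁅ x ⁆) W∪⁅x⁆⊆R (cong suc (trans (∣p∪⁅x⁆∣ x∉W) (cong suc ∣W∣≡m))))
    where
    W∪⁅x⁆⊆R : W ∪ ⁅ x ⁆ ⊆ R
    W∪⁅x⁆⊆R y∈ with x∈p∪q⁻ W ⁅ x ⁆ y∈
    ... | inj₁ y∈W   = W⊆R y∈W
    ... | inj₂ y∈⁅x⁆ = subst (_∈ R) (sym (x∈⁅y⁆⇒x≡y x y∈⁅x⁆)) x∈R

  adjacency-exchange : ∀ {t s} → t ∈ R → s ∈ R → ⟦ adj G v t ⟧ + ⟦ adj G u s ⟧ ≡ ⟦ adj G v s ⟧ + ⟦ adj G u t ⟧
  adjacency-exchange {t} {s} t∈R s∈R with t ≟ s
  ... | yes refl = refl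
  ... | no t≢s with ⊆-of-size m (R - t - s) m≤∣R-t-s∣
    where
    s∈R-t : s ∈ R - t
    s∈R-t = x∈p∧x≢y⇒x∈p-y s∈R (t≢s ∘ sym)
    m≤∣R-t-s∣ : m ≤ ∣ R - t - s ∣
    m≤∣R-t-s∣ = +-cancelˡ-≤ 2 _ _
      (subst (2 + m ≤_) (sym (trans (cong suc (∣p-x∣+1≡∣p∣ s∈R-t)) (∣p-x∣+1≡∣p∣ t∈R))) 2+m≤∣R∣)
  ... | W , W⊆R-t-s , ∣W∣≡m = exchange-arith (deg G u) (deg G v) ∣ N G v ∩ W ∣ ∣ N G u ∩ W ∣
      ⟦ adj G v t ⟧ ⟦ adj G u t ⟧ ⟦ adj G v s ⟧ ⟦ adj G u s ⟧
      (degree-balance-∪⁅⁆ W W⊆R ∣W∣≡m t∈R t∉W) (degree-balance-∪⁅⁆ W W⊆R ∣W∣≡m s∈R s∉W)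
    where
    W⊆R : W ⊆ R
    W⊆R = p─q⊆p R ⁅ t ⁆ ∘ p─q⊆p (R - t) ⁅ s ⁆ ∘ W⊆R-t-s
    t∉W : t ∉ W
    t∉W t∈W = x∈p─q⇒x∉q R ⁅ t ⁆ (p─q⊆p (R - t) ⁅ s ⁆ (W⊆R-t-s t∈W)) (x∈⁅x⁆ t)
    s∉W : s ∉ W
    s∉W s∈W = x∈p─q⇒x∉q (R - t) ⁅ s ⁆ (W⊆R-t-s s∈W) (x∈⁅x⁆ s)

  domination⇒deg≤ : (∀ {s} → s ∈ R → s ∈ N G v → s ∈ N G u) → deg G v ≤ deg G u
  domination⇒deg≤ dominated with ⊆-of-size (suc m) R (≤-trans (n≤1+n (suc m)) 2+m≤∣R∣)
  ... | T , T⊆R , ∣T∣≡1+m = +-cancelʳ-≤ (2 * ∣ N G u ∩ T ∣) (deg G v) (deg G u) (begin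
    deg G v + 2 * ∣ N G u ∩ T ∣ ≡⟨ degree-balance T T⊆R (cong suc ∣T∣≡1+m) ⟨
    deg G u + 2 * ∣ N G v ∩ T ∣ ≤⟨ +-monoʳ-≤ (deg G u) (*-monoʳ-≤ 2 (p⊆q⇒∣p∣≤∣q∣ Nv∩T⊆Nu∩T)) ⟩
    deg G u + 2 * ∣ N G u ∩ T ∣ ∎)
    where
    open ≤-Reasoning
    Nv∩T⊆Nu∩T : N G v ∩ T ⊆ N G u ∩ T
    Nv∩T⊆Nu∩T x∈ with x∈p∩q⁻ (N G v) T x∈
    ... | x∈Nv , x∈T = x∈p∩q⁺ (dominated (T⊆R x∈T) x∈Nv , x∈T)

  R⊆Y : R ⊆ N G v ─ N[_] G u
  R⊆Y {r} r∈R = x∈p∧x∉q⇒x∈p─q (∈N⁺ G (proj₂ u≁r×v~r))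
    ([ ∉N⁺ G (proj₁ u≁r×v~r) , proj₁ (∈R⁻ r∈R) ∘ x∈⁅y⁆⇒x≡y u ] ∘ x∈p∪q⁻ (N G u) ⁅ u ⁆)
    where
    v-not-dominated : ¬ ⟦ adj G v r ⟧ ≤ ⟦ adj G u r ⟧
    v-not-dominated r-dominated = <⇒≱ du<dv (domination⇒deg≤ λ s∈R s∈Nv →
      ∈N⁺ G (⟦⟧≤⟦⟧⇒ (≤-transfer (adjacency-exchange r∈R s∈R) r-dominated) (∈N⁻ G s∈Nv)))
    u≁r×v~r : adj G u r ≡ false × adj G v r ≡ true
    u≁r×v~r = ⟦⟧<⟦⟧ (≰⇒> v-not-dominated)

  X-empty : Empty (N G u ─ N[_] G v)
  X-empty (x , x∈X) = x∈p─q⇒x∉q (N G v) (N[_] G u) (R⊆Y (∈R⁺ (∈N⇒≢ G x∈Nu) x≢v)) (x∈p∪q⁺ (inj₁ x∈Nu))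
    where
    x∈Nu = p─q⊆p (N G u) (N[_] G v) x∈X
    x≢v : x ≢ v
    x≢v refl = x∈p─q⇒x∉q (N G u) (N[_] G v) x∈X (x∈p∪q⁺ (inj₂ (x∈⁅x⁆ v)))

  Z-empty : Empty (R ─ ((N G u ─ N[_] G v) ∪ ((N G v ─ N[_] G u) ∪ (N G u ∩ N G v))))
  Z-empty (x , x∈Z) = x∈p─q⇒x∉q R _ x∈Z (x∈p∪q⁺ (inj₂ (x∈p∪q⁺ (inj₁ (R⊆Y (p─q⊆p R _ x∈Z))))))

corollary2 : (n : ℕ) (G : Graph n) (u v : Fin n) →
    ¬ Regular G → deg G u < deg G v →
    (k : ℕ) → 2 ≤ k → k ≤ n ∸ 2 → TokenRegular G k →
    let R = ⊤ ─ (⁅ u ⁆ ∪ ⁅ v ⁆)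
        X = N G u ─ N[_] G v
        Y = N G v ─ N[_] G u
        W = N G u ∩ N G v
        Z = R ─ (X ∪ (Y ∪ W))
    in X ≡ ⊥ × Z ≡ ⊥
corollary2 n G u v _ du<dv (suc (suc m)) (s≤s (s≤s _)) room regular =
  Empty-unique X-empty , Empty-unique Z-empty
  where open UnequalDegrees G m regular room du<dv
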